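{- Let $m,n,u,v$ be natural numbers and let $\mathrm{Grid}_{(m,n)}^{(v,u)}=(V,E,w)$ be the weighted grid defined in the context. If $\mathrm{Grid}_{(m,n)}^{(v,u)}$ is $w$-Hamiltonian, then $nu+mv \geq mn-1$ and $mv \geq n-1$.
   Context: The weighted grid $\mathrm{Grid}_{(m,n)}^{(v,u)}$ is the graph with vertex set $V=\{0,1,\dots,m\}\times\{0,1,\dots,n\}$, equal to the strong product of the stars $S_m$ and $S_n$ (where $S_k$ has vertex set $\{0,\dots,k\}$ and edges $\{0,i\}$, $1\le i\le k$): two distinct vertices $(i,j),(l,k)$ are adjacent iff ($i=l$ or $i=0$ or $l=0$) and ($j=k$ or $j=0$ or $k=0$). The weight is $w(0,0)=1$, $w(i,0)=v$ for $1\le i\le m$, $w(0,j)=u$ for $1\le j\le n$, $w(i,j)=uv$ for $i,j\ge1$. For a vertex-weighted graph, a $w$-Hamiltonian cycle is a sequence $v_1,\dots,v_N$ of vertices with consecutive terms adjacent and $v_N$ adjacent to $v_1$, in which every vertex occurs and each vertex $x$ occurs at most $w(x)$ times; the graph is $w$-Hamiltonian if such a sequence exists. -}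

module Defs where

open import Data.Nat using (ℕ; zero; suc; _*_; _≤_)
open import Data.Fin using (Fin; zero; suc)
open import Data.Fin.Properties using () renaming (_≟_ to _≟ᶠ_)
open import Data.Product using (_×_; _,_; ∃)
open import Data.Product.Properties using (≡-dec)
open import Data.Sum using (_⊎_)
open import Data.List using (List; []; _∷_; length; filter)
open import Data.List.Membership.Propositional using (_∈_)
open import Relation.Binary.PropositionalEquality using (_≡_)
open import Relation.Nullary using (¬_; Dec)
open import Data.Empty using (⊥)

Vertex : ℕ → ℕ → Set
Vertex m n = Fin (suc m) × Fin (suc n)

-- adjacency in the star S_k, reflexive version: i = l or i = 0 or l = 0
StarRel : ∀ {k} → Fin (suc k) → Fin (suc k) → Set
StarRel i l = (i ≡ l) ⊎ (i ≡ zero) ⊎ (l ≡ zero)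

-- adjacency in the strong product of S_m and S_n (distinct vertices)
Adj : ∀ {m n} → Vertex m n → Vertex m n → Set
Adj (i , j) (l , k) = ¬ ((i , j) ≡ (l , k)) × StarRel i l × StarRel j k

weight : ∀ {m n} (v u : ℕ) → Vertex m n → ℕ
weight v u (zero , zero) = 1
weight v u (suc _ , zero) = v
weight v u (zero , suc _) = u
weight v u (suc _ , suc _) = u * v

_≟V_ : ∀ {m n} (x y : Vertex m n) → Dec (x ≡ y)
_≟V_ = ≡-dec _≟ᶠ_ _≟ᶠ_

count : ∀ {m n} → Vertex m n → List (Vertex m n) → ℕ
count x xs = length (filter (x ≟V_) xs)

ChainTo : ∀ {m n} → Vertex m n → Vertex m n → List (Vertex m n) → Set
ChainTo first prev [] = Adj prev first
ChainTo first prev (x ∷ xs) = Adj prev x × ChainTo first x xs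

CyclicWalk : ∀ {m n} → List (Vertex m n) → Set
CyclicWalk [] = ⊥
CyclicWalk (x ∷ xs) = ChainTo x x xs

record IsWHamCycle (m n v u : ℕ) (c : List (Vertex m n)) : Set where
  field
    walk     : CyclicWalk c
    covers   : ∀ x → x ∈ c
    bounded  : ∀ x → count x c ≤ weight v u x

GridWHamiltonian : (m n v u : ℕ) → Set
GridWHamiltonian m n v u = ∃ λ (c : List (Vertex m n)) → IsWHamCycle m n v u c

-- Both inequalities are double counts along the cycle, read through the
-- successor of each visited vertex.  Inner vertices (i , j), i , j ≥ 1, are
-- pairwise non-adjacent, so each of the at least mn visits to them is followed
-- by a visit to an axis vertex; the axis vertices carry total weight
-- 1 + nu + mv.  For the second inequality, the cycle meets both column j ≥ 1
-- and (0 , 0), so for every j it leaves column j at least once, and the only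
-- neighbours of column j outside it lie in column 0, of total weight 1 + mv.
-- Distinct columns are left at distinct steps.

module Submission where

open import Defs
open import Data.Fin using (Fin; zero; suc; punchIn)
open import Data.Fin.Properties using (_≟_; punchInᵢ≢i; suc-injective)
open import Data.List using (List; []; _∷_; _∷ʳ_; map; filter)
open import Data.List.Properties using (map-∘)
open import Data.List.Membership.Propositional using (_∈_; lose; find)
open import Data.List.Membership.Propositional.Properties using (∈-filter⁺)
open import Data.List.Relation.Unary.All as All using (All; []; _∷_)
open import Data.List.Relation.Unary.Any as Any using (Any; here; there)
open import Data.List.Relation.Binary.Permutation.Propositional.Properties using (map⁺; ∷↭∷ʳ)
open import Data.Nat using (ℕ; zero; suc; _+_; _*_; _∸_; _≤_; _<_; z≤n; s≤s)
open import Data.Nat.ListAction using (sum)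
open import Data.Nat.ListAction.Properties using (sum-↭)
open import Data.Nat.Properties
  using ( +-0-commutativeMonoid; module ≤-Reasoning; ≤-refl; ≤-reflexive; ≤-trans; m≤m+n; m≤n+m
        ; m≤n+o⇒m∸n≤o; +-mono-≤; +-identityʳ; *-identityˡ; *-identityʳ; *-zeroʳ; *-distribʳ-+; *-monoˡ-≤)
open import Data.Nat.Tactic.RingSolver using (solve-∀)
open import Algebra.Properties.CommutativeMonoid.Sum +-0-commutativeMonoid
  using (sum-syntax; sum-cong-≗; sum-remove; sum-replicate-zero; ∑-distrib-+)
open import Data.Product using (_×_; _,_; proj₁; proj₂; uncurry)
open import Data.Sum using (_⊎_; inj₁; inj₂; map₁)
open import Function using (_∘_)
open import Relation.Binary.PropositionalEquality
open import Relation.Nullary using (Dec; yes; no; ¬_; contradiction)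
open import Relation.Unary using (Pred; Decidable; ∁)

indicator : ∀ {p} {P : Set p} → Dec P → ℕ
indicator (yes _) = 1
indicator (no _)  = 0

indicator-yes : ∀ {p} {P : Set p} (d : Dec P) → P → indicator d ≡ 1
indicator-yes (yes _) _  = refl
indicator-yes (no ¬p) p = contradiction p ¬p

indicator-no : ∀ {p} {P : Set p} (d : Dec P) → ¬ P → indicator d ≡ 0
indicator-no (yes p) ¬p = contradiction p ¬p
indicator-no (no _)  _  = refl


∑-mono-≤ : ∀ {k} {f g : Fin k → ℕ} → (∀ i → f i ≤ g i) → ∑[ i < k ] f i ≤ ∑[ i < k ] g i
∑-mono-≤ {zero}  f≤g = z≤n
∑-mono-≤ {suc k} f≤g = +-mono-≤ (f≤g zero) (∑-mono-≤ (f≤g ∘ suc))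

∑-const : ∀ k c → ∑[ i < k ] c ≡ k * c
∑-const zero    c = refl
∑-const (suc k) c = cong (c +_) (∑-const k c)

∑-single : ∀ {k} {f : Fin k → ℕ} (a : Fin k) → (∀ i → i ≢ a → f i ≡ 0) → ∑[ i < k ] f i ≡ f a
∑-single {suc k} {f} a vanish = begin
  ∑[ i < suc k ] f i                 ≡⟨ sum-remove f ⟩
  f a + ∑[ j < k ] f (punchIn a j)   ≡⟨ cong (f a +_) (sum-cong-≗ (λ j → vanish _ (punchInᵢ≢i a j))) ⟩
  f a + ∑[ j < k ] 0                 ≡⟨ cong (f a +_) (sum-replicate-zero k) ⟩
  f a + 0                            ≡⟨ +-identityʳ (f a) ⟩
  f a                                ∎
  where open ≡-Reasoning

∑-indicator-suc≤1 : ∀ {k} (t : Fin (suc k)) → ∑[ j < k ] indicator (t ≟ suc j) ≤ 1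
∑-indicator-suc≤1 {k} zero    = ≤-trans (≤-reflexive (sum-replicate-zero k)) z≤n
∑-indicator-suc≤1     (suc a) = ≤-reflexive (trans
  (∑-single a (λ j j≢a → indicator-no (suc a ≟ suc j) (j≢a ∘ sym ∘ suc-injective)))
  (indicator-yes (suc a ≟ suc a) refl))


sum-map-mono-≤ : ∀ {a} {A : Set a} {f g : A → ℕ} {xs : List A} →
                 All (λ x → f x ≤ g x) xs → sum (map f xs) ≤ sum (map g xs)
sum-map-mono-≤ []           = z≤n
sum-map-mono-≤ (fx≤gx ∷ ps) = +-mono-≤ fx≤gx (sum-map-mono-≤ ps)

∈⇒≤sum-map : ∀ {a} {A : Set a} (f : A → ℕ) {x} {xs : List A} → x ∈ xs → f x ≤ sum (map f xs)
∈⇒≤sum-map f {xs = y ∷ ys} (here refl) = m≤m+n (f y) _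
∈⇒≤sum-map f {xs = y ∷ ys} (there x∈ys) = ≤-trans (∈⇒≤sum-map f x∈ys) (m≤n+m _ (f y))

∑-sum-map : ∀ {a} {A : Set a} k (f : Fin k → A → ℕ) (xs : List A) →
            ∑[ j < k ] sum (map (f j) xs) ≡ sum (map (λ x → ∑[ j < k ] f j x) xs)
∑-sum-map k f []       = sum-replicate-zero k
∑-sum-map k f (x ∷ xs) = trans (∑-distrib-+ (λ j → f j x) (λ j → sum (map (f j) xs)))
                               (cong (∑[ j < k ] f j x +_) (∑-sum-map k f xs))


module _ {a} {A : Set a} where

  steps : A → List A → A → List (A × A)
  steps p []       f = (p , f) ∷ []
  steps p (y ∷ ys) f = (p , y) ∷ steps y ys f

  map-proj₁-steps : ∀ p xs f → map proj₁ (steps p xs f) ≡ p ∷ xs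
  map-proj₁-steps p []       f = refl
  map-proj₁-steps p (y ∷ ys) f = cong (p ∷_) (map-proj₁-steps y ys f)

  map-proj₂-steps : ∀ p xs f → map proj₂ (steps p xs f) ≡ xs ∷ʳ f
  map-proj₂-steps p []       f = refl
  map-proj₂-steps p (y ∷ ys) f = cong (y ∷_) (map-proj₂-steps y ys f)

  sum-map-sources : ∀ (h : A → ℕ) x xs → sum (map (h ∘ proj₁) (steps x xs x)) ≡ sum (map h (x ∷ xs))
  sum-map-sources h x xs = begin
    sum (map (h ∘ proj₁) (steps x xs x))    ≡⟨ cong sum (map-∘ (steps x xs x)) ⟩
    sum (map h (map proj₁ (steps x xs x)))  ≡⟨ cong (sum ∘ map h) (map-proj₁-steps x xs x) ⟩
    sum (map h (x ∷ xs))                    ∎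
    where open ≡-Reasoning

  sum-map-targets : ∀ (h : A → ℕ) x xs → sum (map (h ∘ proj₂) (steps x xs x)) ≡ sum (map h (x ∷ xs))
  sum-map-targets h x xs = begin
    sum (map (h ∘ proj₂) (steps x xs x))    ≡⟨ cong sum (map-∘ (steps x xs x)) ⟩
    sum (map h (map proj₂ (steps x xs x)))  ≡⟨ cong (sum ∘ map h) (map-proj₂-steps x xs x) ⟩
    sum (map h (xs ∷ʳ x))                   ≡⟨ sum-↭ (map⁺ h (∷↭∷ʳ x xs)) ⟨
    sum (map h (x ∷ xs))                    ∎
    where open ≡-Reasoning

  Exit : ∀ {ℓ} → Pred A ℓ → Pred (A × A) ℓ
  Exit P (a , b) = P a × ¬ P b

  module _ {ℓ} {P : Pred A ℓ} (P? : Decidable P) where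

    exit-from-start : ∀ {p xs f} → P p → Any (∁ P) xs ⊎ ¬ P f → Any (Exit P) (steps p xs f)
    exit-from-start {xs = []}     Pp (inj₂ ¬Pf) = here (Pp , ¬Pf)
    exit-from-start {xs = y ∷ ys} Pp later with P? y
    ... | no ¬Py = here (Pp , ¬Py)
    ... | yes Py = there (exit-from-start Py (map₁ (Any.tail (λ ¬Py → ¬Py Py)) later))

    exit-before-end : ∀ {p xs f} → Any P xs → ¬ P f → Any (Exit P) (steps p xs f)
    exit-before-end (here Py)  ¬Pf = there (exit-from-start Py (inj₂ ¬Pf))
    exit-before-end (there Pq) ¬Pf = there (exit-before-end Pq ¬Pf)

    cycle-exit : ∀ {x xs} → Any P (x ∷ xs) → Any (∁ P) (x ∷ xs) → Any (Exit P) (steps x xs x)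
    cycle-exit {x} Pc ¬Pc with P? x
    ... | yes Px = exit-from-start Px (inj₁ (Any.tail (λ ¬Px → ¬Px Px) ¬Pc))
    ... | no ¬Px = exit-before-end (Any.tail ¬Px Pc) ¬Px


module VertexSum (m n : ℕ) where

  ∑V : (Vertex m n → ℕ) → ℕ
  ∑V f = ∑[ i < suc m ] ∑[ j < suc n ] f (i , j)

  ∑V-cong : {f g : Vertex m n → ℕ} → (∀ x → f x ≡ g x) → ∑V f ≡ ∑V g
  ∑V-cong f≗g = sum-cong-≗ (λ i → sum-cong-≗ (λ j → f≗g (i , j)))

  ∑V-zero : ∑V (λ _ → 0) ≡ 0
  ∑V-zero = trans (sum-cong-≗ {suc m} (λ _ → sum-replicate-zero (suc n))) (sum-replicate-zero (suc m))

  ∑V-mono-≤ : {f g : Vertex m n → ℕ} → (∀ x → f x ≤ g x) → ∑V f ≤ ∑V g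
  ∑V-mono-≤ f≤g = ∑-mono-≤ (λ i → ∑-mono-≤ (λ j → f≤g (i , j)))

  ∑V-distrib-+ : (f g : Vertex m n → ℕ) → ∑V (λ x → f x + g x) ≡ ∑V f + ∑V g
  ∑V-distrib-+ f g = trans (sum-cong-≗ (λ i → ∑-distrib-+ (λ j → f (i , j)) (λ j → g (i , j))))
                           (∑-distrib-+ (λ i → ∑[ j < suc n ] f (i , j)) (λ i → ∑[ j < suc n ] g (i , j)))

  ∑V-single : {f : Vertex m n → ℕ} (y : Vertex m n) → (∀ x → x ≢ y → f x ≡ 0) → ∑V f ≡ f y
  ∑V-single (a , b) vanish = trans
    (∑-single a (λ i i≢a → trans (sum-cong-≗ (λ j → vanish (i , j) (i≢a ∘ cong proj₁)))
                                 (sum-replicate-zero (suc n))))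
    (∑-single b (λ j j≢b → vanish (a , j) (j≢b ∘ cong proj₂)))

  count-∷ : ∀ (x y : Vertex m n) c → count x (y ∷ c) ≡ indicator (x ≟V y) + count x c
  count-∷ x y c with x ≟V y
  ... | yes _ = refl
  ... | no _  = refl

  sum-map≡∑V-count : ∀ (h : Vertex m n → ℕ) c → sum (map h c) ≡ ∑V (λ x → count x c * h x)
  sum-map≡∑V-count h []      = sym ∑V-zero
  sum-map≡∑V-count h (y ∷ c) = begin
    h y + sum (map h c)
      ≡⟨ cong₂ _+_ (sym (trans (∑V-single y off-y) at-y)) (sum-map≡∑V-count h c) ⟩
    ∑V (λ x → indicator (x ≟V y) * h x) + ∑V (λ x → count x c * h x)
      ≡⟨ ∑V-distrib-+ (λ x → indicator (x ≟V y) * h x) (λ x → count x c * h x) ⟨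
    ∑V (λ x → indicator (x ≟V y) * h x + count x c * h x)
      ≡⟨ ∑V-cong step ⟩
    ∑V (λ x → count x (y ∷ c) * h x)
      ∎
    where
    open ≡-Reasoning
    off-y : ∀ x → x ≢ y → indicator (x ≟V y) * h x ≡ 0
    off-y x x≢y = cong (_* h x) (indicator-no (x ≟V y) x≢y)
    at-y : indicator (y ≟V y) * h y ≡ h y
    at-y = trans (cong (_* h y) (indicator-yes (y ≟V y) refl)) (*-identityˡ (h y))
    step : ∀ x → indicator (x ≟V y) * h x + count x c * h x ≡ count x (y ∷ c) * h x
    step x = trans (sym (*-distribʳ-+ (h x) (indicator (x ≟V y)) (count x c))) (cong (_* h x) (sym (count-∷ x y c)))

  ∈⇒count-pos : ∀ {x : Vertex m n} {c} → x ∈ c → 0 < count x c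
  ∈⇒count-pos {x} {c} x∈c with filter (x ≟V_) c | ∈-filter⁺ (x ≟V_) x∈c refl
  ... | _ ∷ _ | _ = s≤s z≤n

  covering⇒∑V≤sum-map : ∀ (h : Vertex m n → ℕ) {c} → (∀ x → x ∈ c) → ∑V h ≤ sum (map h c)
  covering⇒∑V≤sum-map h {c} covers = begin
    ∑V h                            ≤⟨ ∑V-mono-≤ visited ⟩
    ∑V (λ x → count x c * h x)      ≡⟨ sum-map≡∑V-count h c ⟨
    sum (map h c)                   ∎
    where
    open ≤-Reasoning
    visited : ∀ x → h x ≤ count x c * h x
    visited x = ≤-trans (≤-reflexive (sym (*-identityˡ (h x)))) (*-monoˡ-≤ (h x) (∈⇒count-pos (covers x)))

  bounded⇒sum-map≤∑V : ∀ (h w : Vertex m n → ℕ) {c} → (∀ x → count x c ≤ w x) →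
                        sum (map h c) ≤ ∑V (λ x → w x * h x)
  bounded⇒sum-map≤∑V h w {c} bounded = begin
    sum (map h c)                   ≡⟨ sum-map≡∑V-count h c ⟩
    ∑V (λ x → count x c * h x)      ≤⟨ ∑V-mono-≤ (λ x → *-monoˡ-≤ (h x) (bounded x)) ⟩
    ∑V (λ x → w x * h x)            ∎
    where open ≤-Reasoning

  ∑V-star : (f : Vertex m n → ℕ) (a b c : ℕ) →
            (∀ j → f (zero , suc j) ≡ a) → (∀ i → f (suc i , zero) ≡ b) → (∀ i j → f (suc i , suc j) ≡ c) →
            ∑V f ≡ (f (zero , zero) + n * a) + m * (b + n * c)
  ∑V-star f a b c on-row₀ on-column₀ inside = cong₂ _+_
    (cong (f (zero , zero) +_) (trans (sum-cong-≗ on-row₀) (∑-const n a)))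
    (trans (sum-cong-≗ (λ i → cong₂ _+_ (on-column₀ i) (trans (sum-cong-≗ (inside i)) (∑-const n c))))
           (∑-const m (b + n * c)))


module Grid (m n : ℕ) where

  open VertexSum m n

  chain⇒All-Adj : ∀ {f p : Vertex m n} xs → ChainTo f p xs → All (uncurry Adj) (steps p xs f)
  chain⇒All-Adj []       p∼f           = p∼f ∷ []
  chain⇒All-Adj (y ∷ ys) (p∼y , chain) = p∼y ∷ chain⇒All-Adj ys chain

  inner : Vertex m n → ℕ
  inner (suc _ , suc _) = 1
  inner _               = 0

  axial : Vertex m n → ℕ
  axial (suc _ , suc _) = 0
  axial _               = 1

  column₀ : Vertex m n → ℕ
  column₀ (_ , zero)  = 1
  column₀ (_ , suc _) = 0

  inner-nonadjacent : ∀ {i l j k} → ¬ Adj {m} {n} (suc i , suc j) (suc l , suc k)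
  inner-nonadjacent (distinct , i∼l , j∼k) = distinct (cong₂ _,_ (StarRel-suc i∼l) (StarRel-suc j∼k))
    where
    StarRel-suc : ∀ {t} {i l : Fin t} → StarRel (suc i) (suc l) → suc i ≡ suc l
    StarRel-suc (inj₁ i≡l)        = i≡l
    StarRel-suc (inj₂ (inj₁ ()))
    StarRel-suc (inj₂ (inj₂ ()))

  Adj⇒inner≤axial : ∀ {a b : Vertex m n} → Adj a b → inner a ≤ axial b
  Adj⇒inner≤axial {zero  , _}     {_}             _   = z≤n
  Adj⇒inner≤axial {suc _ , zero}  {_}             _   = z≤n
  Adj⇒inner≤axial {suc _ , suc _} {zero  , _}     _   = ≤-refl
  Adj⇒inner≤axial {suc _ , suc _} {suc _ , zero}  _   = ≤-refl
  Adj⇒inner≤axial {suc _ , suc _} {suc _ , suc _} adj = contradiction adj inner-nonadjacent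

  InColumn : Fin n → Vertex m n → Set
  InColumn j x = proj₂ x ≡ suc j

  inColumn? : ∀ j → Decidable (InColumn j)
  inColumn? j x = proj₂ x ≟ suc j

  leaving-column-enters-column₀ : ∀ {a b : Vertex m n} {j} → Adj a b → InColumn j a → ¬ InColumn j b → proj₂ b ≡ zero
  leaving-column-enters-column₀ (_ , _ , inj₁ a≡b)        a∈j b∉j = contradiction (trans (sym a≡b) a∈j) b∉j
  leaving-column-enters-column₀ (_ , _ , inj₂ (inj₂ b≡0)) _   _   = b≡0
  leaving-column-enters-column₀ (_ , _ , inj₂ (inj₁ a≡0)) a∈j _ with () ← trans (sym a∈j) a≡0

  columnExit : Fin n → Vertex m n × Vertex m n → ℕ
  columnExit j (a , (_ , zero))  = indicator (inColumn? j a)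
  columnExit j (a , (_ , suc _)) = 0

  ∑-columnExit≤column₀ : ∀ s → ∑[ j < n ] columnExit j s ≤ column₀ (proj₂ s)
  ∑-columnExit≤column₀ (a , (_ , zero))  = ∑-indicator-suc≤1 (proj₂ a)
  ∑-columnExit≤column₀ (a , (_ , suc _)) = ≤-reflexive (sum-replicate-zero n)

  exit⇒columnExit-pos : ∀ {a b : Vertex m n} {j} → Adj a b → Exit (InColumn j) (a , b) → 0 < columnExit j (a , b)
  exit⇒columnExit-pos {a} {_ , _} {j} adj (a∈j , b∉j) with leaving-column-enters-column₀ adj a∈j b∉j
  ... | refl = ≤-reflexive (sym (indicator-yes (inColumn? j a) a∈j))

  ∑V-inner : ∑V inner ≡ m * n
  ∑V-inner = trans (∑V-star inner 0 0 1 (λ _ → refl) (λ _ → refl) (λ _ _ → refl)) (arith m n)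
    where
    arith : ∀ m n → (0 + n * 0) + m * (0 + n * 1) ≡ m * n
    arith = solve-∀

  ∑V-weight-axial : ∀ v u → ∑V (λ x → weight v u x * axial x) ≡ 1 + (n * u + m * v)
  ∑V-weight-axial v u = trans
    (∑V-star (λ x → weight v u x * axial x) u v 0 (λ _ → *-identityʳ u) (λ _ → *-identityʳ v) (λ _ _ → *-zeroʳ (u * v)))
    (arith m n u v)
    where
    arith : ∀ m n u v → (1 + n * u) + m * (v + n * 0) ≡ 1 + (n * u + m * v)
    arith = solve-∀

  ∑V-weight-column₀ : ∀ v u → ∑V (λ x → weight v u x * column₀ x) ≡ 1 + m * v
  ∑V-weight-column₀ v u = trans
    (∑V-star (λ x → weight v u x * column₀ x) 0 v 0 (λ _ → *-zeroʳ u) (λ _ → *-identityʳ v) (λ _ _ → *-zeroʳ (u * v)))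
    (arith m n v)
    where
    arith : ∀ m n v → (1 + n * 0) + m * (v + n * 0) ≡ 1 + m * v
    arith = solve-∀


module _ {m n v u : ℕ} {x : Vertex m n} {xs : List (Vertex m n)} (ham : IsWHamCycle m n v u (x ∷ xs)) where

  open IsWHamCycle ham
  open VertexSum m n
  open Grid m n

  private
    adjacent : All (uncurry Adj) (steps x xs x)
    adjacent = chain⇒All-Adj xs walk

  inner-visits-bound : m * n ≤ 1 + (n * u + m * v)
  inner-visits-bound = begin
    m * n                                   ≡⟨ ∑V-inner ⟨
    ∑V inner                                ≤⟨ covering⇒∑V≤sum-map inner covers ⟩
    sum (map inner (x ∷ xs))                ≡⟨ sum-map-sources inner x xs ⟨
    sum (map (inner ∘ proj₁) (steps x xs x)) ≤⟨ sum-map-mono-≤ (All.map Adj⇒inner≤axial adjacent) ⟩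
    sum (map (axial ∘ proj₂) (steps x xs x)) ≡⟨ sum-map-targets axial x xs ⟩
    sum (map axial (x ∷ xs))                ≤⟨ bounded⇒sum-map≤∑V axial (weight v u) bounded ⟩
    ∑V (λ y → weight v u y * axial y)       ≡⟨ ∑V-weight-axial v u ⟩
    1 + (n * u + m * v)                     ∎
    where open ≤-Reasoning

  column-exited : ∀ j → 0 < sum (map (columnExit j) (steps x xs x))
  column-exited j
    with s , s∈steps , exit ← find (cycle-exit (inColumn? j) (lose (covers (zero , suc j)) refl)
                                                            (lose (covers (zero , zero)) λ ()))
    = ≤-trans (exit⇒columnExit-pos (All.lookup adjacent s∈steps) exit) (∈⇒≤sum-map (columnExit j) s∈steps)

  column-exits-bound : n ≤ 1 + m * v
  column-exits-bound = begin
    n                                                      ≡⟨ trans (∑-const n 1) (*-identityʳ n) ⟨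
    ∑[ j < n ] 1                                           ≤⟨ ∑-mono-≤ column-exited ⟩
    ∑[ j < n ] sum (map (columnExit j) (steps x xs x))     ≡⟨ ∑-sum-map n columnExit (steps x xs x) ⟩
    sum (map (λ s → ∑[ j < n ] columnExit j s) (steps x xs x))
                                                           ≤⟨ sum-map-mono-≤ {xs = steps x xs x} (All.tabulate (λ {s} _ → ∑-columnExit≤column₀ s)) ⟩
    sum (map (column₀ ∘ proj₂) (steps x xs x))                ≡⟨ sum-map-targets column₀ x xs ⟩
    sum (map column₀ (x ∷ xs))                                ≤⟨ bounded⇒sum-map≤∑V column₀ (weight v u) bounded ⟩
    ∑V (λ y → weight v u y * column₀ y)                       ≡⟨ ∑V-weight-column₀ v u ⟩
    1 + m * v                                              ∎
    where open ≤-Reasoning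

mainTheorem3 : (m n u v : ℕ) → GridWHamiltonian m n v u →
    ((m * n) ∸ 1 ≤ (n * u) + (m * v)) × (n ∸ 1 ≤ m * v)
mainTheorem3 m n u v ([] , record { walk = () })
mainTheorem3 m n u v (_ ∷ _ , ham) =
  m≤n+o⇒m∸n≤o (m * n) 1 (inner-visits-bound ham) , m≤n+o⇒m∸n≤o n 1 (column-exits-bound ham)
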